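{- Let $G$ be a graph with $n$ vertices and $S(G)=N$. Then $$|E(G)|\le\begin{cases}\left\lfloor\frac{Nn}{2}-\frac{N^2}{8}-\frac{N}{8}+\frac{\lfloor\frac{N+1}{2}\rfloor}{4}\right\rfloor & \text{if } N\le n-1,\\[2mm] \left\lfloor\frac{Nn}{4}+\frac{n^2}{8}-\frac{N}{4}+\frac{n}{8}+\frac{\lfloor\frac{N+1}{2}\rfloor}{4}-\frac14\right\rfloor & \text{if } N\ge n.\end{cases}$$
   Context: For a finite simple graph $G=(V,E)$ and an injective map $f:V\to\mathbb Z$, let $\sigma(G,f)=\{f(v)+f(w): vw\in E\}$. The sum index of $G$ is $S(G)=\min_{f}|\sigma(G,f)|$ over all injective $f:V\to\mathbb Z$. -}

module Defs where

open import Data.Bool using (Bool; true; false; T)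
open import Data.Bool.Properties using (T?)
open import Data.Nat as ℕ using (ℕ)
open import Data.Integer as ℤ using (ℤ)
open import Data.Fin as Fin using (Fin)
open import Data.Fin.Properties using (_<?_)
open import Data.List using (List; length; map; filter; cartesianProduct; deduplicate)
open import Data.Product using (_×_; _,_; ∃)
open import Relation.Binary.PropositionalEquality using (_≡_)
open import Relation.Nullary using (¬_)
open import Relation.Nullary.Decidable using (_×-dec_)
open import Function.Definitions using (Injective)

record SimpleGraph (n : ℕ) : Set where
  field
    adj   : Fin n → Fin n → Bool
    sym   : ∀ i j → adj i j ≡ adj j i
    irref : ∀ i → adj i i ≡ false

open SimpleGraph public

edges : ∀ {n} → SimpleGraph n → List (Fin n × Fin n)
edges {n} G =
  filter (λ p → (Data.Product.proj₁ p <? Data.Product.proj₂ p)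
                 ×-dec T? (adj G (Data.Product.proj₁ p) (Data.Product.proj₂ p)))
         (cartesianProduct (Data.List.allFin n) (Data.List.allFin n))

numEdges : ∀ {n} → SimpleGraph n → ℕ
numEdges G = length (edges G)

InjLabel : ℕ → Set
InjLabel n = Data.Product.Σ (Fin n → ℤ) (Injective _≡_ _≡_)

sigmaSize : ∀ {n} → SimpleGraph n → (Fin n → ℤ) → ℕ
sigmaSize G f =
  length (deduplicate ℤ._≟_
    (map (λ p → f (Data.Product.proj₁ p) ℤ.+ f (Data.Product.proj₂ p)) (edges G)))

SumIndexIs : ∀ {n} → SimpleGraph n → ℕ → Set
SumIndexIs {n} G N =
  (∃ λ (f : InjLabel n) → sigmaSize G (Data.Product.proj₁ f) ≡ N)
  × (∀ (f : InjLabel n) → N ℕ.≤ sigmaSize G (Data.Product.proj₁ f))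

{-# OPTIONS --safe #-}
-- Record every edge as the pair a < b of its labels under an injective labelling whose sums
-- form a set T of size N. Let lo be the least label and hi the greatest of the others. The
-- edges through lo or hi have pairwise distinct sums, since lo + b < a + hi whenever a ≠ lo,
-- and there are at most 2k + 1 of them when k further labels remain; peeling lo and hi off
-- repeatedly gives |E| ≤ peelBound n N = Σ min (N , 2k + 1).
-- Bounding the outer layers by N and an inner block of m labels (n = 2j + m) by the complete
-- graph gives 8 · peelBound n N ≤ 4Nn − N² − 2N + x (x − 2) with x = 2m − N. The two bounds
-- of the theorem are 4Nn − N² − 2N + (N + 2⌈N/2⌉) and 4Nn − N² − 2N + ((N − n)² + n + 2⌈N/2⌉ − 2),
-- and their last terms dominate x (x − 2) once m has the parity of n and x ∈ {0, 1, 2, 3}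
-- (possible when N ≤ 2n), or m = n when N > 2n.
module Submission where

open import Defs hiding (sym)
open import Data.Nat as ℕ using (ℕ)
open import Data.Integer as ℤ using (ℤ; +_)
open import Data.Product using (_×_)

open import Data.Nat using (zero; suc; z≤n; s≤s)
open import Data.Product using (_,_; proj₁; proj₂; ∃-syntax)
open import Data.Sum using (_⊎_; inj₁; inj₂; [_,_]′)
open import Data.Empty using (⊥-elim)
open import Data.Fin as Fin using (Fin)
open import Data.List
  using (List; []; _∷_; length; map; filter; _++_; allFin; cartesianProduct; deduplicate)
open import Data.List.Membership.Propositional using (_∈_)
open import Data.List.Relation.Unary.Any using (here; there)
import Data.List.Relation.Unary.All as All
import Data.List.Relation.Unary.All.Properties as All
open import Data.List.Relation.Unary.AllPairs using ([]; _∷_)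
open import Data.List.Relation.Binary.Subset.Propositional using (_⊆_)
open import Data.List.Relation.Unary.Unique.Propositional using (Unique)
open import Function using (_∘_; id)
open import Function.Definitions using (Injective)
open import Relation.Binary.Definitions using (DecidableEquality)
open import Relation.Binary.PropositionalEquality
open import Relation.Nullary using (¬_; yes; no)
open import Relation.Unary using (Pred; Decidable)
open import Relation.Unary.Properties using (∁?)

module ListCounting where
  open import Data.Nat using (_+_; _≤_)
  open import Data.Nat.Properties using (+-suc)

  module _ {A : Set} (_≟_ : DecidableEquality A) where

    remove : A → List A → List A
    remove x []       = []
    remove x (y ∷ ys) with x ≟ y
    ... | yes _ = ys
    ... | no  _ = y ∷ remove x ys

    length-remove : ∀ {x ys} → x ∈ ys → suc (length (remove x ys)) ≡ length ys
    length-remove {x} {y ∷ ys} x∈ with x ≟ y | x∈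
    ... | yes _   | _          = refl
    ... | no  x≢y | here x≡y   = ⊥-elim (x≢y x≡y)
    ... | no  _   | there x∈ys = cong suc (length-remove x∈ys)

    ∈-remove⁺ : ∀ {x z ys} → z ∈ ys → z ≢ x → z ∈ remove x ys
    ∈-remove⁺ {x} {ys = y ∷ ys} z∈ z≢x with x ≟ y | z∈
    ... | yes refl | here refl  = ⊥-elim (z≢x refl)
    ... | yes refl | there z∈ys = z∈ys
    ... | no  _    | here z≡y   = here z≡y
    ... | no  _    | there z∈ys = there (∈-remove⁺ z∈ys z≢x)

    Unique⇒length≤ : ∀ {xs ys} → Unique xs → xs ⊆ ys → length xs ≤ length ys
    Unique⇒length≤ {[]}     _            _     = z≤n
    Unique⇒length≤ {x ∷ xs} (x∉xs ∷ xs!) xs⊆ys =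
      subst (suc (length xs) ≤_) (length-remove (xs⊆ys (here refl)))
        (s≤s (Unique⇒length≤ xs! λ y∈xs →
          ∈-remove⁺ (xs⊆ys (there y∈xs)) (λ y≡x → All.lookup x∉xs y∈xs (sym y≡x))))

  map-injectiveOn⁺ : ∀ {A B : Set} {f : A → B} {xs} →
    (∀ {x y} → x ∈ xs → y ∈ xs → f x ≡ f y → x ≡ y) → Unique xs → Unique (map f xs)
  map-injectiveOn⁺ {xs = []}     _   []           = []
  map-injectiveOn⁺ {xs = x ∷ xs} inj (x∉xs ∷ xs!) =
    All.map⁺ (All.tabulate λ y∈xs → All.lookup x∉xs y∈xs ∘ inj (here refl) (there y∈xs))
    ∷ map-injectiveOn⁺ (λ x∈ y∈ → inj (there x∈) (there y∈)) xs!

  length-filter+filter-∁ : ∀ {A : Set} {p} {P : Pred A p} (P? : Decidable P) xs →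
    length xs ≡ length (filter P? xs) + length (filter (∁? P?) xs)
  length-filter+filter-∁ P? []       = refl
  length-filter+filter-∁ P? (x ∷ xs) with P? x
  ... | yes _ = cong suc (length-filter+filter-∁ P? xs)
  ... | no  _ = trans (cong suc (length-filter+filter-∁ P? xs)) (sym (+-suc _ _))

module Extremes where
  open import Data.Integer using (_≤_)
  open import Data.Integer.Properties using (≤-totalOrder)
  open import Data.List.Extrema ≤-totalOrder
    using (min; max; argmin-sel; argmax-sel; min≤⊤; min≤xs; ⊥≤max; xs≤max)

  least : ∀ {k} V → length V ≡ suc k → ∃[ lo ] lo ∈ V × (∀ {v} → v ∈ V → lo ≤ v)
  least (x ∷ xs) _ = min x xs , [ here , there ]′ (argmin-sel id x xs) , λ
    { (here refl) → min≤⊤ x xs ; (there v∈xs) → All.lookup (min≤xs x xs) v∈xs }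

  greatest : ∀ {k} V → length V ≡ suc k → ∃[ hi ] hi ∈ V × (∀ {v} → v ∈ V → v ≤ hi)
  greatest (x ∷ xs) _ = max x xs , [ here , there ]′ (argmax-sel id x xs) , λ
    { (here refl) → ⊥≤max x xs ; (there v∈xs) → All.lookup (xs≤max x xs) v∈xs }

module PeelBound where
  open import Data.Nat using (_+_; _*_; _≤_; _⊓_)
  open import Data.Nat.Properties
    using ( m⊓n≤m; m⊓n≤n; ≤-refl; +-assoc; +-mono-≤; +-monoˡ-≤; +-monoʳ-≤; *-monoʳ-≤; +-suc
          ; module ≤-Reasoning)
  open import Data.Nat.Tactic.RingSolver using (solve-∀)
  open ≤-Reasoning

  peelBound : ℕ → ℕ → ℕ
  peelBound 0             N = 0
  peelBound 1             N = 0
  peelBound (suc (suc k)) N = N ⊓ suc (k + k) + peelBound k N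

  peelBound-complete : ∀ m N → 2 * peelBound m N + m ≤ m * m
  peelBound-complete 0             N = z≤n
  peelBound-complete 1             N = s≤s z≤n
  peelBound-complete (suc (suc k)) N = begin
    2 * (N ⊓ suc (k + k) + peelBound k N) + suc (suc k)
      ≤⟨ +-monoˡ-≤ _ (*-monoʳ-≤ 2 (+-monoˡ-≤ _ (m⊓n≤n N _))) ⟩
    2 * (suc (k + k) + peelBound k N) + suc (suc k)
      ≡⟨ regroup k (peelBound k N) ⟩
    (2 * peelBound k N + k) + 4 * (k + 1)
      ≤⟨ +-monoˡ-≤ _ (peelBound-complete k N) ⟩
    k * k + 4 * (k + 1)
      ≡⟨ square k ⟩
    suc (suc k) * suc (suc k) ∎
    where
    regroup : ∀ k b → 2 * (suc (k + k) + b) + suc (suc k) ≡ (2 * b + k) + 4 * (k + 1)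
    regroup = solve-∀
    square : ∀ k → k * k + 4 * (k + 1) ≡ suc (suc k) * suc (suc k)
    square = solve-∀

  peelBound-shift : ∀ j m N → peelBound (j + j + m) N ≤ j * N + peelBound m N
  peelBound-shift zero    m N = ≤-refl
  peelBound-shift (suc j) m N rewrite +-suc j j = begin
    N ⊓ _ + peelBound (j + j + m) N  ≤⟨ +-mono-≤ (m⊓n≤m N _) (peelBound-shift j m N) ⟩
    N + (j * N + peelBound m N)      ≡⟨ +-assoc N (j * N) _ ⟨
    suc j * N + peelBound m N        ∎

  peelBound-quadratic : ∀ j m N → 2 * peelBound (j + j + m) N + m ≤ 2 * (j * N) + m * m
  peelBound-quadratic j m N = begin
    2 * peelBound (j + j + m) N + m         ≤⟨ +-monoˡ-≤ m (*-monoʳ-≤ 2 (peelBound-shift j m N)) ⟩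
    2 * (j * N + peelBound m N) + m         ≡⟨ regroup (j * N) (peelBound m N) m ⟩
    2 * (j * N) + (2 * peelBound m N + m)   ≤⟨ +-monoʳ-≤ _ (peelBound-complete m N) ⟩
    2 * (j * N) + m * m                     ∎
    where
    regroup : ∀ a b m → 2 * (a + b) + m ≡ 2 * a + (2 * b + m)
    regroup = solve-∀

open PeelBound

module SumEdges (T : List ℤ) where
  open import Data.Nat.Properties as ℕP using (suc-injective)
  open import Data.Integer using (_+_; _<_; _≤_)
  open import Data.Integer.Properties
    using (≤-<-trans; <-≤-trans; ≤∧≢⇒<; <⇒≢; <-irrefl; +-mono-<-≤; +-0-abelianGroup)
  open import Algebra.Bundles using (AbelianGroup)
  open import Algebra.Properties.Group (AbelianGroup.group +-0-abelianGroup)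
    using (∙-cancelˡ; ∙-cancelʳ)
  open import Data.List.Membership.Propositional.Properties
    using (∈-filter⁻; ∈-map⁺; ∈-map⁻; ∈-++⁺ˡ; ∈-++⁺ʳ)
  open import Data.List.Properties using (length-map; length-++)
  open import Data.List.Relation.Unary.Unique.Propositional.Properties using (filter⁺)
  open import Data.Product.Properties using (≡-dec)
  open import Relation.Nullary.Decidable using (_⊎-dec_)
  open ListCounting
  open Extremes

  edgeSum : ℤ × ℤ → ℤ
  edgeSum (a , b) = a + b

  record SumEdge (V : List ℤ) (e : ℤ × ℤ) : Set where
    constructor sumEdge
    field
      ordered : proj₁ e < proj₂ e
      fst∈    : proj₁ e ∈ V
      snd∈    : proj₂ e ∈ V
      sum∈    : edgeSum e ∈ T

  record Peeling (V : List ℤ) : Set where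
    field
      lo hi        : ℤ
      inner        : List ℤ
      length-inner : suc (suc (length inner)) ≡ length V
      lo≤          : ∀ {v} → v ∈ V → lo ≤ v
      ≤hi          : ∀ {v} → v ∈ V → lo < v → v ≤ hi
      ∈inner       : ∀ {v} → v ∈ V → lo < v → v < hi → v ∈ inner

  peel : ∀ {k} V → length V ≡ suc (suc k) → Peeling V
  peel V |V|≡2+k = record
    { lo           = lo
    ; hi           = hi
    ; inner        = remove ℤ._≟_ hi V′
    ; length-inner = trans (cong suc (length-remove ℤ._≟_ hi∈V′)) (length-remove ℤ._≟_ lo∈V)
    ; lo≤          = lo≤
    ; ≤hi          = λ v∈V lo<v → ≤hi (∈V′ v∈V lo<v)
    ; ∈inner       = λ v∈V lo<v v<hi → ∈-remove⁺ ℤ._≟_ (∈V′ v∈V lo<v) (<⇒≢ v<hi)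
    }
    where
    lo       = proj₁ (least V |V|≡2+k)
    lo∈V     = proj₁ (proj₂ (least V |V|≡2+k))
    lo≤      = proj₂ (proj₂ (least V |V|≡2+k))
    V′       = remove ℤ._≟_ lo V
    |V′|≡1+k = suc-injective (trans (length-remove ℤ._≟_ lo∈V) |V|≡2+k)
    hi       = proj₁ (greatest V′ |V′|≡1+k)
    hi∈V′    = proj₁ (proj₂ (greatest V′ |V′|≡1+k))
    ≤hi      = proj₂ (proj₂ (greatest V′ |V′|≡1+k))
    ∈V′ : ∀ {v} → v ∈ V → lo < v → v ∈ V′
    ∈V′ v∈V lo<v = ∈-remove⁺ ℤ._≟_ v∈V (λ v≡lo → <⇒≢ lo<v (sym v≡lo))

  module Peeled {V} (P : Peeling V) where
    open Peeling P

    Touches : ℤ × ℤ → Set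
    Touches (a , b) = a ≡ lo ⊎ b ≡ hi

    touches? : Decidable Touches
    touches? (a , b) = (a ℤ.≟ lo) ⊎-dec (b ℤ.≟ hi)

    candidates : List (ℤ × ℤ)
    candidates = map (lo ,_) (hi ∷ inner) ++ map (_, hi) inner

    length-candidates : length candidates ≡ suc (length inner ℕ.+ length inner)
    length-candidates = trans (length-++ (map (lo ,_) (hi ∷ inner)))
      (cong₂ ℕ._+_ (length-map (lo ,_) (hi ∷ inner)) (length-map (_, hi) inner))

    private
      lo<fst : ∀ {a} → a ∈ V → a ≢ lo → lo < a
      lo<fst a∈V a≢lo = ≤∧≢⇒< (lo≤ a∈V) (λ lo≡a → a≢lo (sym lo≡a))

      lo<snd : ∀ {a b} → SumEdge V (a , b) → lo < b
      lo<snd (sumEdge a<b a∈V _ _) = ≤-<-trans (lo≤ a∈V) a<b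

      snd≤hi : ∀ {a b} → SumEdge V (a , b) → b ≤ hi
      snd≤hi e@(sumEdge _ _ b∈V _) = ≤hi b∈V (lo<snd e)

      snd∈hi∷inner : ∀ {a b} → SumEdge V (a , b) → b ∈ hi ∷ inner
      snd∈hi∷inner {b = b} e@(sumEdge _ _ b∈V _) with b ℤ.≟ hi
      ... | yes b≡hi = here b≡hi
      ... | no  b≢hi = there (∈inner b∈V (lo<snd e) (≤∧≢⇒< (snd≤hi e) b≢hi))

      classify : ∀ {a b} → SumEdge V (a , b) → Touches (a , b) → a ≡ lo ⊎ (lo < a × b ≡ hi)
      classify {a} (sumEdge _ a∈V _ _) touches with a ℤ.≟ lo | touches
      ... | yes a≡lo | _         = inj₁ a≡lo
      ... | no  a≢lo | inj₁ a≡lo = ⊥-elim (a≢lo a≡lo)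
      ... | no  a≢lo | inj₂ b≡hi = inj₂ (lo<fst a∈V a≢lo , b≡hi)

    touching⇒candidate : ∀ {e} → SumEdge V e → Touches e → e ∈ candidates
    touching⇒candidate {a , b} e touches with classify e touches
    ... | inj₁ refl          = ∈-++⁺ˡ (∈-map⁺ (lo ,_) (snd∈hi∷inner e))
    ... | inj₂ (lo<a , refl) = ∈-++⁺ʳ (map (lo ,_) (hi ∷ inner))
                                 (∈-map⁺ (_, hi) (∈inner (SumEdge.fst∈ e) lo<a (SumEdge.ordered e)))

    touching-edgeSum-injective : ∀ {e e′} → SumEdge V e → Touches e → SumEdge V e′ → Touches e′ →
                                 edgeSum e ≡ edgeSum e′ → e ≡ e′
    touching-edgeSum-injective {a , b} {a′ , b′} e t e′ t′ s≡s′ with classify e t | classify e′ t′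
    ... | inj₁ refl          | inj₁ refl           = cong (lo ,_) (∙-cancelˡ lo b b′ s≡s′)
    ... | inj₂ (_ , refl)    | inj₂ (_ , refl)     = cong (_, hi) (∙-cancelʳ hi a a′ s≡s′)
    ... | inj₁ refl          | inj₂ (lo<a′ , refl) = ⊥-elim (<⇒≢ (+-mono-<-≤ lo<a′ (snd≤hi e)) s≡s′)
    ... | inj₂ (lo<a , refl) | inj₁ refl           = ⊥-elim (<⇒≢ (+-mono-<-≤ lo<a (snd≤hi e′)) (sym s≡s′))

    untouched⇒inner : ∀ {e} → SumEdge V e → ¬ Touches e → SumEdge inner e
    untouched⇒inner {a , b} e@(sumEdge a<b a∈V b∈V sum∈T) untouched = sumEdge a<b
      (∈inner a∈V lo<a (<-≤-trans a<b (snd≤hi e)))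
      (∈inner b∈V (lo<snd e) (≤∧≢⇒< (snd≤hi e) (λ b≡hi → untouched (inj₂ b≡hi))))
      sum∈T
      where lo<a = lo<fst a∈V (λ a≡lo → untouched (inj₁ a≡lo))

  sumEdges≤peelBound : ∀ k V → length V ≡ k → ∀ {E} → Unique E →
                       (∀ {e} → e ∈ E → SumEdge V e) → length E ℕ.≤ peelBound k (length T)
  sumEdges≤peelBound 0 []       _ {[]}    _ _ = z≤n
  sumEdges≤peelBound 0 []       _ {_ ∷ _} _ sumEdges with sumEdges (here refl)
  ... | sumEdge _ () _ _
  sumEdges≤peelBound 1 (x ∷ []) _ {[]}    _ _ = z≤n
  sumEdges≤peelBound 1 (x ∷ []) _ {_ ∷ _} _ sumEdges with sumEdges (here refl)
  ... | sumEdge a<b (here refl) (here refl) _ = ⊥-elim (<-irrefl refl a<b)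
  sumEdges≤peelBound (suc (suc k)) V |V|≡2+k {E} E! sumEdges = begin
    length E                                               ≡⟨ length-filter+filter-∁ touches? E ⟩
    length E₁ ℕ.+ length E₂                                ≤⟨ ℕP.+-mono-≤ (ℕP.⊓-glb E₁≤T E₁≤2k+1) E₂≤ ⟩
    length T ℕ.⊓ suc (k ℕ.+ k) ℕ.+ peelBound k (length T)  ∎
    where
    open ℕP.≤-Reasoning
    P = peel V |V|≡2+k
    open Peeling P
    open Peeled P
    E₁ = filter touches? E
    E₂ = filter (∁? touches?) E
    |inner|≡k : length inner ≡ k
    |inner|≡k = suc-injective (suc-injective (trans length-inner |V|≡2+k))
    touching : ∀ {e} → e ∈ E₁ → SumEdge V e × Touches e
    touching e∈E₁ = let e∈E , t = ∈-filter⁻ touches? {xs = E} e∈E₁ in sumEdges e∈E , t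
    edgeSum-injective : ∀ {e e′} → e ∈ E₁ → e′ ∈ E₁ → edgeSum e ≡ edgeSum e′ → e ≡ e′
    edgeSum-injective e∈ e′∈ =
      let e , t = touching e∈ ; e′ , t′ = touching e′∈ in touching-edgeSum-injective e t e′ t′
    sums⊆T : map edgeSum E₁ ⊆ T
    sums⊆T s∈ = let _ , e∈E₁ , s≡ = ∈-map⁻ edgeSum s∈ in
      subst (_∈ T) (sym s≡) (SumEdge.sum∈ (proj₁ (touching e∈E₁)))
    E₁≤T : length E₁ ℕ.≤ length T
    E₁≤T = subst (ℕ._≤ length T) (length-map edgeSum E₁)
      (Unique⇒length≤ ℤ._≟_ (map-injectiveOn⁺ edgeSum-injective (filter⁺ touches? E!)) sums⊆T)
    E₁≤2k+1 : length E₁ ℕ.≤ suc (k ℕ.+ k)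
    E₁≤2k+1 = subst (length E₁ ℕ.≤_)
      (trans length-candidates (cong (λ i → suc (i ℕ.+ i)) |inner|≡k))
      (Unique⇒length≤ (≡-dec ℤ._≟_ ℤ._≟_) (filter⁺ touches? E!)
        (λ e∈E₁ → let e , t = touching e∈E₁ in touching⇒candidate e t))
    E₂≤ : length E₂ ℕ.≤ peelBound k (length T)
    E₂≤ = sumEdges≤peelBound k inner |inner|≡k (filter⁺ (∁? touches?) E!)
      (λ e∈E₂ → let e∈E , ¬t = ∈-filter⁻ (∁? touches?) {xs = E} e∈E₂ in
        untouched⇒inner (sumEdges e∈E) ¬t)
  sumEdges≤peelBound 0 (_ ∷ _)     ()
  sumEdges≤peelBound 1 []          ()
  sumEdges≤peelBound 1 (_ ∷ _ ∷ _) ()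

module Halving where
  open import Data.Nat using (_+_; _≤_; _<_; _≤?_)
  open import Data.Nat.Properties
    using ( +-suc; +-comm; +-identityʳ; +-cancelˡ-≤; +-cancelˡ-<; +-monoˡ-≤; ≰⇒>
          ; m≤n⇒∃[o]m+o≡n; even≢odd)
  open import Data.Nat.DivMod using (_/_; /-monoˡ-≤)

  halve : ∀ n N → N ≤ n + n → ∃[ j ] ∃[ m ] ∃[ r ] r < 4 × n ≡ j + j + m × m + m ≡ N + r
  halve n N N≤2n with 4 + N ≤? n + n
  halve 0 N _ | yes ()
  halve 1 N _ | yes (s≤s (s≤s ()))
  halve (suc (suc n)) N _ | yes (s≤s (s≤s 2+N≤)) =
    let j , m , r , r<4 , n≡2j+m , m+m≡N+r = halve n N N≤2n in
    suc j , m , r , r<4 , cong suc (trans (cong suc n≡2j+m) (cong (_+ m) (sym (+-suc j j)))) , m+m≡N+r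
    where
    N≤2n : N ≤ n + n
    N≤2n = +-cancelˡ-≤ 2 N (n + n)
      (subst (2 + N ≤_) (trans (+-suc n (suc n)) (cong suc (+-suc n n))) 2+N≤)
  halve n N N≤2n | no 4+N≰2n =
    let r , N+r≡2n = m≤n⇒∃[o]m+o≡n N≤2n in
    0 , n , r , +-cancelˡ-< N r 4 (subst₂ _<_ (sym N+r≡2n) (+-comm 4 N) (≰⇒> 4+N≰2n)) ,
    refl , sym N+r≡2n

  odd⇒positive : ∀ {m N} → m + m ≡ N + 3 → 1 ≤ N
  odd⇒positive {m} {zero}  m+m≡3 =
    ⊥-elim (even≢odd m 1 (trans (cong (λ k → m + k) (+-identityʳ m)) m+m≡3))
  odd⇒positive {N = suc _} _     = s≤s z≤n

  1≤[n+1]/2 : ∀ {n} → 1 ≤ n → 1 ≤ (n + 1) / 2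
  1≤[n+1]/2 1≤n = /-monoˡ-≤ 2 (+-monoˡ-≤ 1 1≤n)

module ClosedFormBounds where
  open import Data.Nat.Properties as ℕP using ()
  open import Data.Nat.DivMod using (_/_; m*n/n≡m; /-monoˡ-≤)
  import Data.Nat.Tactic.RingSolver as ℕ-Solver
  open import Data.Integer using (_+_; _-_; _*_; _⊖_; _≤_; +≤+; -≤+; _/ℕ_)
  open import Data.Integer.Properties
    using (pos-*; ≤-trans; +-monoʳ-≤; i≤i+j; ≤-⊖; m-n≡m⊖n; module ≤-Reasoning)
  open import Data.Integer.Tactic.RingSolver using (solve-∀)
  open Halving
  open ≤-Reasoning

  leading : ℕ → ℕ → ℤ
  leading n N = (+ 4) * + N * + n - + N * + N - (+ 2) * + N

  bound₁ : ℕ → ℕ → ℤ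
  bound₁ n N = (+ 4) * + N * + n - + N * + N - + N + (+ 2) * + ((N ℕ.+ 1) / 2)

  bound₂ : ℕ → ℕ → ℤ
  bound₂ n N = (+ 2) * + N * + n + + n * + n - (+ 2) * + N + + n + (+ 2) * + ((N ℕ.+ 1) / 2) - + 2

  m+n≤o⇒+m≤+o-+n : ∀ {m n o} → m ℕ.+ n ℕ.≤ o → + m ≤ + o - + n
  m+n≤o⇒+m≤+o-+n {m} {n} {o} m+n≤o = begin
    + m           ≤⟨ +≤+ (ℕP.m+n≤o⇒m≤o∸n m m+n≤o) ⟩
    + (o ℕ.∸ n)   ≡⟨ ≤-⊖ (ℕP.m+n≤o⇒n≤o m m+n≤o) ⟨
    o ⊖ n         ≡⟨ m-n≡m⊖n o n ⟨
    + o - + n     ∎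

  8*peelBound≤leading : ∀ j m N → let x = + (m ℕ.+ m) - + N in
    + (8 ℕ.* peelBound (j ℕ.+ j ℕ.+ m) N) ≤ leading (j ℕ.+ j ℕ.+ m) N + x * (x - + 2)
  8*peelBound≤leading j m N = begin
    + (8 ℕ.* peelBound (j ℕ.+ j ℕ.+ m) N)
      ≤⟨ m+n≤o⇒+m≤+o-+n fourfold ⟩
    + (8 ℕ.* (j ℕ.* N) ℕ.+ 4 ℕ.* (m ℕ.* m)) - + (4 ℕ.* m)
      ≡⟨ cong₂ _-_ (cong₂ _+_ (pos-** 8 j N) (pos-** 4 m m)) (pos-* 4 m) ⟩
    (+ 8) * (+ j * + N) + (+ 4) * (+ m * + m) - (+ 4) * + m
      ≡⟨ identity (+ j) (+ m) (+ N) ⟩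
    leading (j ℕ.+ j ℕ.+ m) N + x * (x - + 2) ∎
    where
    x = + (m ℕ.+ m) - + N
    B = peelBound (j ℕ.+ j ℕ.+ m) N
    fourfold : 8 ℕ.* B ℕ.+ 4 ℕ.* m ℕ.≤ 8 ℕ.* (j ℕ.* N) ℕ.+ 4 ℕ.* (m ℕ.* m)
    fourfold = subst₂ ℕ._≤_ (times4 B m) (times4 (j ℕ.* N) (m ℕ.* m))
      (ℕP.*-monoʳ-≤ 4 (peelBound-quadratic j m N))
      where
      times4 : ∀ a b → 4 ℕ.* (2 ℕ.* a ℕ.+ b) ≡ 8 ℕ.* a ℕ.+ 4 ℕ.* b
      times4 = ℕ-Solver.solve-∀
    pos-** : ∀ a b c → + (a ℕ.* (b ℕ.* c)) ≡ + a * (+ b * + c)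
    pos-** a b c = trans (pos-* a (b ℕ.* c)) (cong (+ a *_) (pos-* b c))
    identity : ∀ j m N → let x = m + m - N in
      (+ 8) * (j * N) + (+ 4) * (m * m) - (+ 4) * m
        ≡ ((+ 4) * N * (j + j + m) - N * N - (+ 2) * N) + x * (x - + 2)
    identity = solve-∀

  +[m+m]-+N≡+r : ∀ {m N r} → m ℕ.+ m ≡ N ℕ.+ r → + (m ℕ.+ m) - + N ≡ + r
  +[m+m]-+N≡+r {N = N} {r} m+m≡N+r = trans (cong (λ k → + k - + N) m+m≡N+r) (cancel (+ N) (+ r))
    where
    cancel : ∀ N r → N + r - N ≡ r
    cancel = solve-∀

  r[r-2]≤N+2⌈N/2⌉ : ∀ {m N} r → r ℕ.< 4 → m ℕ.+ m ≡ N ℕ.+ r →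
    + r * (+ r - + 2) ≤ + (N ℕ.+ 2 ℕ.* ((N ℕ.+ 1) / 2))
  r[r-2]≤N+2⌈N/2⌉     0 _ _ = +≤+ z≤n
  r[r-2]≤N+2⌈N/2⌉     1 _ _ = -≤+
  r[r-2]≤N+2⌈N/2⌉     2 _ _ = +≤+ z≤n
  r[r-2]≤N+2⌈N/2⌉ {m} 3 _ m+m≡N+3 = +≤+ (ℕP.+-mono-≤ N≥1 (ℕP.*-monoʳ-≤ 2 (1≤[n+1]/2 N≥1)))
    where N≥1 = odd⇒positive {m} m+m≡N+3
  r[r-2]≤N+2⌈N/2⌉ (suc (suc (suc (suc _)))) (s≤s (s≤s (s≤s (s≤s ())))) _

  8*peelBound≤bound₁ : ∀ n N → N ℕ.≤ n ℕ.+ n → + (8 ℕ.* peelBound n N) ≤ bound₁ n N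
  8*peelBound≤bound₁ n N N≤2n with halve n N N≤2n
  ... | j , m , r , r<4 , refl , m+m≡N+r = begin
    + (8 ℕ.* peelBound n N)
      ≤⟨ 8*peelBound≤leading j m N ⟩
    leading n N + x * (x - + 2)
      ≡⟨ cong (λ x → leading n N + x * (x - + 2)) (+[m+m]-+N≡+r {m} {N} m+m≡N+r) ⟩
    leading n N + + r * (+ r - + 2)
      ≤⟨ +-monoʳ-≤ (leading n N) (r[r-2]≤N+2⌈N/2⌉ {m} r r<4 m+m≡N+r) ⟩
    leading n N + + (N ℕ.+ 2 ℕ.* h)
      ≡⟨ cong (λ t → leading n N + (+ N + t)) (pos-* 2 h) ⟩
    leading n N + (+ N + (+ 2) * + h)
      ≡⟨ split (+ n) (+ N) (+ h) ⟨
    bound₁ n N ∎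
    where
    h = (N ℕ.+ 1) / 2
    x = + (m ℕ.+ m) - + N
    split : ∀ n N h → (+ 4) * N * n - N * N - N + (+ 2) * h
                    ≡ ((+ 4) * N * n - N * N - (+ 2) * N) + (N + (+ 2) * h)
    split = solve-∀

  r[r-2]≤d²+n+2⌈[n+d]/2⌉-2 : ∀ {n d m} r → r ℕ.< 4 → 1 ℕ.≤ n → m ℕ.≤ n → m ℕ.+ m ≡ n ℕ.+ d ℕ.+ r →
    + r * (+ r - + 2) ≤ + (d ℕ.* d ℕ.+ (n ℕ.+ 2 ℕ.* ((n ℕ.+ d ℕ.+ 1) / 2))) - + 2
  r[r-2]≤d²+n+2⌈[n+d]/2⌉-2 {n} {d} {m} r r<4 1≤n m≤n = bound r r<4
    where
    K = d ℕ.* d ℕ.+ (n ℕ.+ 2 ℕ.* ((n ℕ.+ d ℕ.+ 1) / 2))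
    k+2≤K : ∀ {k} → k ℕ.≤ n → k ℕ.+ 2 ℕ.≤ K
    k+2≤K k≤n = ℕP.≤-trans
      (ℕP.+-mono-≤ k≤n (ℕP.*-monoʳ-≤ 2 (1≤[n+1]/2 (ℕP.≤-trans 1≤n (ℕP.m≤m+n n d)))))
      (ℕP.m≤n+m _ (d ℕ.* d))
    bound : ∀ r → r ℕ.< 4 → m ℕ.+ m ≡ n ℕ.+ d ℕ.+ r → + r * (+ r - + 2) ≤ + K - + 2
    bound 0 _ _ = m+n≤o⇒+m≤+o-+n (k+2≤K z≤n)
    bound 1 _ _ = ≤-trans -≤+ (m+n≤o⇒+m≤+o-+n {0} (k+2≤K z≤n))
    bound 2 _ _ = m+n≤o⇒+m≤+o-+n (k+2≤K z≤n)
    bound 3 _ m+m≡N+3 = m+n≤o⇒+m≤+o-+n (k+2≤K 3≤n)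
      where
      3≤n : 3 ℕ.≤ n
      3≤n = ℕP.+-cancelˡ-≤ n 3 n (ℕP.≤-trans (ℕP.+-monoˡ-≤ 3 (ℕP.m≤m+n n d))
              (subst (ℕ._≤ n ℕ.+ n) m+m≡N+3 (ℕP.+-mono-≤ m≤n m≤n)))
    bound (suc (suc (suc (suc _)))) (s≤s (s≤s (s≤s (s≤s ())))) _

  8*peelBound≤bound₂-near : ∀ n d → 1 ℕ.≤ n → d ℕ.≤ n →
    + (8 ℕ.* peelBound n (n ℕ.+ d)) ≤ bound₂ n (n ℕ.+ d)
  8*peelBound≤bound₂-near n d 1≤n d≤n with halve n (n ℕ.+ d) (ℕP.+-monoʳ-≤ n d≤n)
  ... | j , m , r , r<4 , refl , m+m≡N+r = begin
    + (8 ℕ.* peelBound n N)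
      ≤⟨ 8*peelBound≤leading j m N ⟩
    leading n N + x * (x - + 2)
      ≡⟨ cong (λ x → leading n N + x * (x - + 2)) (+[m+m]-+N≡+r {m} {N} m+m≡N+r) ⟩
    leading n N + + r * (+ r - + 2)
      ≤⟨ +-monoʳ-≤ (leading n N) (r[r-2]≤d²+n+2⌈[n+d]/2⌉-2 {m = m} r r<4 1≤n m≤n m+m≡N+r) ⟩
    leading n N + (+ (d ℕ.* d ℕ.+ (n ℕ.+ 2 ℕ.* h)) - + 2)
      ≡⟨ cong₂ (λ s t → leading n N + (s + (+ n + t) - + 2)) (pos-* d d) (pos-* 2 h) ⟩
    leading n N + (+ d * + d + (+ n + (+ 2) * + h) - + 2)
      ≡⟨ split (+ n) (+ d) (+ h) ⟨
    bound₂ n N ∎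
    where
    N = n ℕ.+ d
    h = (N ℕ.+ 1) / 2
    x = + (m ℕ.+ m) - + N
    m≤n = ℕP.m≤n+m m (j ℕ.+ j)
    split : ∀ n d h → let N = n + d in
      (+ 2) * N * n + n * n - (+ 2) * N + n + (+ 2) * h - + 2
        ≡ ((+ 4) * N * n - N * N - (+ 2) * N) + (d * d + (n + (+ 2) * h) - + 2)
    split = solve-∀

  -- bound₂ n N − leading n N − x (x − 2) = (n − 1) (2N − 3n + 2) + 2h, which is nonnegative
  -- as N ≥ 2n; writing n = 1 + p and N = 2n + u gives the slack below.
  8*peelBound≤bound₂-far : ∀ p u → let n = suc p ; N = n ℕ.+ (n ℕ.+ u) in
    + (8 ℕ.* peelBound n N) ≤ bound₂ n N
  8*peelBound≤bound₂-far p u = begin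
    + (8 ℕ.* peelBound n N)                    ≤⟨ 8*peelBound≤leading 0 n N ⟩
    leading n N + x * (x - + 2)                ≤⟨ i≤i+j _ (+ slack) ⟩
    leading n N + x * (x - + 2) + + slack
      ≡⟨ cong (λ t → leading n N + x * (x - + 2) + (t + + (h ℕ.+ h))) (pos-* p _) ⟩
    leading n N + x * (x - + 2) + (+ p * + (p ℕ.+ 3 ℕ.+ (u ℕ.+ u)) + + (h ℕ.+ h))
      ≡⟨ split (+ p) (+ u) (+ h) ⟨
    bound₂ n N                                 ∎
    where
    n = suc p
    N = n ℕ.+ (n ℕ.+ u)
    h = (N ℕ.+ 1) / 2
    x = + (n ℕ.+ n) - + N
    slack = p ℕ.* (p ℕ.+ 3 ℕ.+ (u ℕ.+ u)) ℕ.+ (h ℕ.+ h)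
    split : ∀ p u h → let n = + 1 + p ; N = n + (n + u) ; x = n + n - N in
      (+ 2) * N * n + n * n - (+ 2) * N + n + (+ 2) * h - + 2
        ≡ ((+ 4) * N * n - N * N - (+ 2) * N) + x * (x - + 2) + (p * (p + + 3 + (u + u)) + (h + h))
    split = solve-∀

  8*peelBound≤bound₂ : ∀ n N → 1 ℕ.≤ n → n ℕ.≤ N → + (8 ℕ.* peelBound n N) ≤ bound₂ n N
  8*peelBound≤bound₂ n N 1≤n n≤N with ℕP.m≤n⇒∃[o]m+o≡n n≤N
  ... | d , refl with n ℕ.≤? d
  ...   | no  n≰d = 8*peelBound≤bound₂-near n d 1≤n (ℕP.<⇒≤ (ℕP.≰⇒> n≰d))
  ...   | yes n≤d with ℕP.m≤n⇒∃[o]m+o≡n n≤d | 1≤n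
  ...     | u , refl | s≤s {n = p} _ = 8*peelBound≤bound₂-far p u

  ≤-/ℕ : ∀ {e b} d .{{_ : ℕ.NonZero d}} {i} → e ℕ.≤ b → + (d ℕ.* b) ≤ i → + e ≤ i /ℕ d
  ≤-/ℕ {b = b} d {+ k} e≤b (+≤+ db≤k) = +≤+ (ℕP.≤-trans e≤b
    (subst (ℕ._≤ k / d) (m*n/n≡m b d) (/-monoˡ-≤ d (subst (ℕ._≤ k) (ℕP.*-comm d b) db≤k))))

module Orientation where
  open import Data.Integer using (_<_; _≤_; _<?_)
  open import Data.Integer.Properties using (≮⇒≥)
  open import Data.Product using (swap)
  open import Data.Product.Properties using (,-injective)

  orient : ℤ → ℤ → ℤ × ℤ
  orient a b with a <? b
  ... | yes _ = a , b
  ... | no  _ = b , a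

  orient-cases : ∀ a b → (orient a b ≡ (a , b) × a < b) ⊎ (orient a b ≡ (b , a) × b ≤ a)
  orient-cases a b with a <? b
  ... | yes a<b = inj₁ (refl , a<b)
  ... | no  a≮b = inj₂ (refl , ≮⇒≥ a≮b)

  orient-injective : ∀ {a b c d} → orient a b ≡ orient c d → (a ≡ c × b ≡ d) ⊎ (a ≡ d × b ≡ c)
  orient-injective {a} {b} {c} {d} eq with orient-cases a b | orient-cases c d
  ... | inj₁ (ab , _) | inj₁ (cd , _) = inj₁ (,-injective (trans (sym ab) (trans eq cd)))
  ... | inj₁ (ab , _) | inj₂ (dc , _) = inj₂ (,-injective (trans (sym ab) (trans eq dc)))
  ... | inj₂ (ba , _) | inj₁ (cd , _) = inj₂ (swap (,-injective (trans (sym ba) (trans eq cd))))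
  ... | inj₂ (ba , _) | inj₂ (dc , _) = inj₁ (swap (,-injective (trans (sym ba) (trans eq dc))))

module LabelledEdges {n} (G : SimpleGraph n) (f : Fin n → ℤ) (f-injective : Injective _≡_ _≡_ f) where
  open import Data.Integer using (_+_)
  open import Data.Integer.Properties using (+-comm; ≤∧≢⇒<)
  open import Data.Fin.Properties using (<-asym; <-irrefl)
  open import Data.List.Properties using (length-map; length-tabulate)
  open import Data.List.Membership.Propositional.Properties
    using (∈-filter⁻; ∈-map⁺; ∈-map⁻; ∈-allFin; ∈-deduplicate⁺)
  open import Data.List.Relation.Unary.Unique.Propositional.Properties
    using (filter⁺; cartesianProduct⁺; allFin⁺)
  open Orientation
  open ListCounting

  sums : List ℤ
  sums = deduplicate ℤ._≟_ (map (λ p → f (proj₁ p) + f (proj₂ p)) (edges G))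

  open SumEdges sums

  labels : List ℤ
  labels = map f (allFin n)

  labelEdge : Fin n × Fin n → ℤ × ℤ
  labelEdge (i , j) = orient (f i) (f j)

  edge-< : ∀ {i j} → (i , j) ∈ edges G → i Fin.< j
  edge-< e∈ = proj₁ (proj₂ (∈-filter⁻ _ {xs = cartesianProduct (allFin n) (allFin n)} e∈))

  label∈labels : ∀ i → f i ∈ labels
  label∈labels i = ∈-map⁺ f (∈-allFin i)

  sum∈sums : ∀ {i j} → (i , j) ∈ edges G → f i + f j ∈ sums
  sum∈sums e∈ = ∈-deduplicate⁺ ℤ._≟_ (∈-map⁺ _ e∈)

  labelEdge-sumEdge : ∀ {e} → e ∈ edges G → SumEdge labels (labelEdge e)
  labelEdge-sumEdge {i , j} e∈ with orient-cases (f i) (f j)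
  ... | inj₁ (≡ij , fi<fj) = subst (SumEdge labels) (sym ≡ij)
          (sumEdge fi<fj (label∈labels i) (label∈labels j) (sum∈sums e∈))
  ... | inj₂ (≡ji , fj≤fi) = subst (SumEdge labels) (sym ≡ji)
          (sumEdge (≤∧≢⇒< fj≤fi fj≢fi) (label∈labels j) (label∈labels i)
            (subst (_∈ sums) (+-comm (f i) (f j)) (sum∈sums e∈)))
    where
    fj≢fi : f j ≢ f i
    fj≢fi fj≡fi with f-injective fj≡fi
    ... | refl = <-irrefl refl (edge-< e∈)

  labelEdge-injective : ∀ {e e′} → e ∈ edges G → e′ ∈ edges G →
                        labelEdge e ≡ labelEdge e′ → e ≡ e′
  labelEdge-injective {i , j} {i′ , j′} e∈ e′∈ same with orient-injective same
  ... | inj₁ (fi≡fi′ , fj≡fj′) = cong₂ _,_ (f-injective fi≡fi′) (f-injective fj≡fj′)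
  ... | inj₂ (fi≡fj′ , fj≡fi′) with f-injective fi≡fj′ | f-injective fj≡fi′
  ...   | refl | refl = ⊥-elim (<-asym (edge-< e∈) (edge-< e′∈))

  numEdges≤peelBound : numEdges G ℕ.≤ peelBound n (sigmaSize G f)
  numEdges≤peelBound = subst (ℕ._≤ peelBound n (sigmaSize G f)) (length-map labelEdge (edges G))
    (sumEdges≤peelBound n labels (trans (length-map f (allFin n)) (length-tabulate (λ i → i)))
      (map-injectiveOn⁺ labelEdge-injective
        (filter⁺ _ (cartesianProduct⁺ (allFin⁺ n) (allFin⁺ n))))
      λ e∈ → let _ , e∈G , e≡ = ∈-map⁻ labelEdge e∈ in
        subst (SumEdge labels) (sym e≡) (labelEdge-sumEdge e∈G))

open ClosedFormBounds using (≤-/ℕ; 8*peelBound≤bound₁; 8*peelBound≤bound₂)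
open LabelledEdges using (numEdges≤peelBound)

theorem3p4 : ∀ (n : ℕ) (G : SimpleGraph n) (N : ℕ) → 1 ℕ.≤ n → SumIndexIs G N →
      (N ℕ.≤ n ℕ.∸ 1 →
        + numEdges G ℤ.≤
          ((+ 4) ℤ.* + N ℤ.* + n ℤ.- + N ℤ.* + N ℤ.- + N ℤ.+ (+ 2) ℤ.* + ((N ℕ.+ 1) ℕ./ 2)) ℤ./ℕ 8)
      × (n ℕ.≤ N →
        + numEdges G ℤ.≤
          ((+ 2) ℤ.* + N ℤ.* + n ℤ.+ + n ℤ.* + n ℤ.- (+ 2) ℤ.* + N ℤ.+ + n
            ℤ.+ (+ 2) ℤ.* + ((N ℕ.+ 1) ℕ./ 2) ℤ.- + 2) ℤ./ℕ 8)
theorem3p4 n G N 1≤n (((f , f-injective) , |σ|≡N) , _) =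
  (λ N≤n-1 → ≤-/ℕ 8 edges≤ (8*peelBound≤bound₁ n N (N≤2n N≤n-1))) ,
  (λ n≤N   → ≤-/ℕ 8 edges≤ (8*peelBound≤bound₂ n N 1≤n n≤N))
  where
  open import Data.Nat.Properties using (≤-trans; m∸n≤m; m≤m+n)
  edges≤ : numEdges G ℕ.≤ peelBound n N
  edges≤ = subst (λ s → numEdges G ℕ.≤ peelBound n s) |σ|≡N (numEdges≤peelBound G f f-injective)
  N≤2n : N ℕ.≤ n ℕ.∸ 1 → N ℕ.≤ n ℕ.+ n
  N≤2n N≤n-1 = ≤-trans N≤n-1 (≤-trans (m∸n≤m n 1) (m≤m+n n n))
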